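{- Let $p:\mathbb{Y}^*\to\mathbb{Y}$ be the map $(\lambda,\Box)\mapsto\lambda$. For any $\Lambda^{(m)}\in\mathbb{Y}^*$ and any path $\lambda^{(m)}\nearrow\lambda^{(m+1)}\nearrow\cdots$ in the Young graph with $\lambda^{(m)}=p(\Lambda^{(m)})$, there exists a unique path $\Lambda^{(m)}\nearrow\Lambda^{(m+1)}\nearrow\cdots$ in the augmented Young graph starting at the given $\Lambda^{(m)}$ such that $p(\Lambda^{(t)})=\lambda^{(t)}$ for each $t\in\{m,m+1,\dots\}$.
   Context: $\mathbb{Y}$ is the set of Young diagrams; boxes are identified with coordinates $(x,y)\in\mathbb{N}_0^2$ of their lower-left corners ($x$ = column, $y$ = row). In the Young graph, $\lambda\nearrow\widetilde\lambda$ means $\widetilde\lambda$ is obtained from $\lambda$ by adding one box. An outer corner of $\lambda$ is a box not in $\lambda$ whose addition to $\lambda$ gives a Young diagram. $\mathbb{Y}^*$ is the set of augmented Young diagrams, i.e. pairs $(\lambda,\Box)$ with $\lambda\in\mathbb{Y}$ and $\Box$ an outer corner of $\lambda$. Augmented Young graph on $\mathbb{Y}^*$: $(\lambda,\Box)\nearrow(\widetilde\lambda,\widetilde\Box)$ iff $\lambda\nearrow\widetilde\lambda$ and $\widetilde\Box$ is the outer corner of $\widetilde\lambda$ lying in the row directly above $\Box$ if $\widetilde\lambda/\lambda=\{\Box\}$, while $\widetilde\Box=\Box$ otherwise. -}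

module Defs where

open import Data.Nat using (ℕ; zero; suc; _<_; _≤_; _≤ᵇ_; _<ᵇ_)
open import Data.Nat.Properties using (_≟_)
open import Data.Bool using (Bool; true; false; _∧_)
open import Data.Unit using (⊤)
open import Data.Empty using (⊥)
open import Data.List using (List; []; _∷_)
open import Data.Product using (Σ; ∃; _×_; _,_; proj₁; proj₂)
open import Data.Sum using (_⊎_)
open import Relation.Nullary using (¬_)
open import Relation.Binary.PropositionalEquality using (_≡_)
open import Function.Bundles using (_⇔_)

-- A box is identified with its lower-left corner (x , y): x = column, y = row.
Box : Set
Box = ℕ × ℕ

-- Young diagrams are encoded by their list of row lengths (row 0 first),
-- which must be weakly decreasing with all entries positive.
isPartition : List ℕ → Bool
isPartition [] = true
isPartition (a ∷ []) = 1 ≤ᵇ a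
isPartition (a ∷ b ∷ l) = (b ≤ᵇ a) ∧ isPartition (b ∷ l)

T : Bool → Set
T true = ⊤
T false = ⊥

record YD : Set where
  constructor yd
  field
    rows  : List ℕ
    valid : T (isPartition rows)
open YD public

rowLen : List ℕ → ℕ → ℕ
rowLen [] y = 0
rowLen (a ∷ l) zero = a
rowLen (a ∷ l) (suc y) = rowLen l y

_∈YD_ : Box → YD → Set
(x , y) ∈YD λ' = x < rowLen (rows λ') y

Adds : YD → Box → YD → Set
Adds λ' □ μ = (¬ (□ ∈YD λ')) × (∀ b → (b ∈YD μ) ⇔ ((b ∈YD λ') ⊎ b ≡ □))

_↗_ : YD → YD → Set
λ' ↗ μ = ∃ λ □ → Adds λ' □ μ

OuterCorner : YD → Box → Set
OuterCorner λ' □ = ∃ λ μ → Adds λ' □ μ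

record AYD : Set where
  constructor ayd
  field
    diag   : YD
    corner : Box
    isOC   : OuterCorner diag corner
open AYD public

p : AYD → YD
p = diag

_↗*_ : AYD → AYD → Set
Λ ↗* Λ' =
  (diag Λ ↗ diag Λ')
  × (Adds (diag Λ) (corner Λ) (diag Λ') → proj₂ (corner Λ') ≡ suc (proj₂ (corner Λ)))
  × (¬ Adds (diag Λ) (corner Λ) (diag Λ') → corner Λ' ≡ corner Λ)

_≈A_ : AYD → AYD → Set
Λ ≈A Λ' = (diag Λ ≡ diag Λ') × (corner Λ ≡ corner Λ')

IsLift : ℕ → AYD → (ℕ → YD) → (ℕ → AYD) → Set
IsLift m Λm λs Λ =
  (Λ m ≈A Λm)
  × (∀ t → m ≤ t → Λ t ↗* Λ (suc t))
  × (∀ t → m ≤ t → p (Λ t) ≡ λs t)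

-- An augmented diagram (λ , □) follows an edge λ ↗ μ of the Young graph
-- in exactly one way: if the added box is □ itself, the mark moves to the
-- outer corner of μ in the row above; otherwise □ is still an outer corner
-- of μ and the mark stays.  Paths therefore lift edge by edge, uniquely.
--
-- Everything rests on a description of diagrams by row lengths.  Adding
-- the box (x , y) means that row y grows from length x to x + 1 while the
-- other rows are unchanged (adds⇒growsRow, growsRow⇒adds), and (x , y) is an outer corner
-- exactly when row y has length x and, for y > 0, row y − 1 is longer
-- than x (outerCorner-row, outerCorner-supported, outerCorner-intro).
module Submission where

open import Defs
open import Data.Nat using (ℕ; zero; suc; _≤_; _<_; _∸_; _+_; _≤ᵇ_; z≤n; s≤s)
open import Data.Nat.Properties
open import Data.Bool using (true; false)
open import Data.Unit using (⊤; tt)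
open import Data.Empty using (⊥-elim)
open import Data.List using (List; []; _∷_)
open import Data.Product using (Σ; _×_; _,_; proj₁; proj₂)
open import Data.Product.Properties using (≡-dec; ,-injectiveˡ)
open import Data.Sum using (_⊎_; inj₁; inj₂; [_,_]′)
import Data.Sum as Sum
open import Function using (_∘_)
open import Function.Bundles using (_⇔_; mk⇔; Equivalence)
open import Function.Construct.Composition using (_⇔-∘_)
open import Function.Construct.Symmetry using (⇔-sym)
open import Relation.Nullary using (¬_; Dec; yes; no)
open import Relation.Binary.PropositionalEquality
  using (_≡_; _≢_; refl; sym; trans; cong; subst; ≢-sym)

open Equivalence using (to; from)
open ≤-Reasoning

<-⊆⇒≤ : ∀ {a b} → (∀ z → z < a → z < b) → a ≤ b
<-⊆⇒≤ {a} {b} below = ≮⇒≥ (λ b<a → <-irrefl refl (below b b<a))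

<-ext : ∀ {a b} → (∀ z → z < a ⇔ z < b) → a ≡ b
<-ext same = ≤-antisym (<-⊆⇒≤ (λ z → to (same z))) (<-⊆⇒≤ (λ z → from (same z)))

<-suc⇔ : ∀ {z x} → z < suc x ⇔ (z < x ⊎ z ≡ x)
<-suc⇔ = mk⇔ m<1+n⇒m<n∨m≡n [ m<n⇒m<1+n , (λ z≡x → s≤s (≤-reflexive z≡x)) ]′

-- If the numbers below b are those below a together with some x ≥ a,
-- then x = a and b = a + 1: this is one row growing by one box.
<-extension : ∀ {a b x} → ¬ x < a → (∀ z → z < b ⇔ (z < a ⊎ z ≡ x)) → a ≡ x × b ≡ suc x
<-extension {a} {b} {x} x≮a below-b = a≡x , <-ext (λ z → ⇔-sym <-suc⇔ ⇔-∘ below-b′ z)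
  where
  a≮x : ¬ a < x
  a≮x a<x with to (below-b a) (<-trans a<x (from (below-b x) (inj₂ refl)))
  ... | inj₁ a<a = <-irrefl refl a<a
  ... | inj₂ a≡x = <-irrefl a≡x a<x

  a≡x : a ≡ x
  a≡x = ≤-antisym (≮⇒≥ x≮a) (≮⇒≥ a≮x)

  below-b′ : ∀ z → z < b ⇔ (z < x ⊎ z ≡ x)
  below-b′ = subst (λ c → ∀ z → z < b ⇔ (z < c ⊎ z ≡ x)) a≡x below-b

partition-uncons : ∀ a b l → T (isPartition (a ∷ b ∷ l)) → b ≤ a × T (isPartition (b ∷ l))
partition-uncons a b l valid with b ≤ᵇ a | ≤ᵇ⇒≤ b a
... | true  | ≤ᵇ⇒≤′ = ≤ᵇ⇒≤′ tt , valid
... | false | _     = ⊥-elim valid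

partition-cons : ∀ a b l → b ≤ a → T (isPartition (b ∷ l)) → T (isPartition (a ∷ b ∷ l))
partition-cons a b l b≤a valid with b ≤ᵇ a | ≤⇒≤ᵇ b≤a
... | true  | _  = valid
... | false | ()

rowLen-antitone : ∀ l → T (isPartition l) → ∀ y → rowLen l (suc y) ≤ rowLen l y
rowLen-antitone []          _     _       = z≤n
rowLen-antitone (a ∷ [])    _     _       = z≤n
rowLen-antitone (a ∷ b ∷ l) valid zero    = proj₁ (partition-uncons a b l valid)
rowLen-antitone (a ∷ b ∷ l) valid (suc y) =
  rowLen-antitone (b ∷ l) (proj₂ (partition-uncons a b l valid)) y

Supported : List ℕ → ℕ → ℕ → Set
Supported l zero    x = ⊤
Supported l (suc z) x = x < rowLen l z

supported-mono : ∀ {l l′} y {x} → (∀ z → rowLen l z ≤ rowLen l′ z)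
  → Supported l y x → Supported l′ y x
supported-mono zero    _      _   = tt
supported-mono (suc z) longer sup = <-≤-trans sup (longer z)

growRow : List ℕ → ℕ → List ℕ
growRow []      zero    = 1 ∷ []
growRow []      (suc y) = 0 ∷ growRow [] y
growRow (a ∷ l) zero    = suc a ∷ l
growRow (a ∷ l) (suc y) = a ∷ growRow l y

growRow-here : ∀ l y → rowLen (growRow l y) y ≡ suc (rowLen l y)
growRow-here []      zero    = refl
growRow-here []      (suc y) = growRow-here [] y
growRow-here (a ∷ l) zero    = refl
growRow-here (a ∷ l) (suc y) = growRow-here l y

growRow-elsewhere : ∀ l {y} y′ → y′ ≢ y → rowLen (growRow l y) y′ ≡ rowLen l y′
growRow-elsewhere []      {zero}  zero     y′≢y = ⊥-elim (y′≢y refl)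
growRow-elsewhere []      {zero}  (suc y′) _    = refl
growRow-elsewhere []      {suc y} zero     _    = refl
growRow-elsewhere []      {suc y} (suc y′) y′≢y = growRow-elsewhere [] y′ (y′≢y ∘ cong suc)
growRow-elsewhere (a ∷ l) {zero}  zero     y′≢y = ⊥-elim (y′≢y refl)
growRow-elsewhere (a ∷ l) {zero}  (suc y′) _    = refl
growRow-elsewhere (a ∷ l) {suc y} zero     _    = refl
growRow-elsewhere (a ∷ l) {suc y} (suc y′) y′≢y = growRow-elsewhere l y′ (y′≢y ∘ cong suc)

growRow-valid : ∀ l y → T (isPartition l) → Supported l y (rowLen l y)
  → T (isPartition (growRow l y))
growRow-valid []          zero          _     _   = tt
growRow-valid []          (suc _)       _     ()
growRow-valid (a ∷ [])    zero          _     _   = tt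
growRow-valid (a ∷ [])    (suc zero)    _     0<a = partition-cons a 1 [] 0<a tt
growRow-valid (a ∷ [])    (suc (suc _)) _     ()
growRow-valid (a ∷ b ∷ l) zero          valid _   =
  let b≤a , tail = partition-uncons a b l valid
  in  partition-cons (suc a) b l (m≤n⇒m≤1+n b≤a) tail
growRow-valid (a ∷ b ∷ l) (suc zero)    valid b<a =
  let _ , tail = partition-uncons a b l valid
  in  partition-cons a (suc b) l b<a (growRow-valid (b ∷ l) zero tail tt)
growRow-valid (a ∷ b ∷ l) (suc (suc y)) valid sup =
  let b≤a , tail = partition-uncons a b l valid
  in  partition-cons a b (growRow l y) b≤a (growRow-valid (b ∷ l) (suc y) tail sup)

row : YD → ℕ → ℕ
row l = rowLen (rows l)

GrowsRow : YD → Box → YD → Set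
GrowsRow l (x , y) μ =
  row l y ≡ x × row μ y ≡ suc x × (∀ y′ → y′ ≢ y → row μ y′ ≡ row l y′)

sameRow⇔ : ∀ {P : Set} {z x y : ℕ} → (P ⊎ z ≡ x) ⇔ (P ⊎ (z , y) ≡ (x , y))
sameRow⇔ {y = y} = mk⇔ (Sum.map₂ (cong (_, y))) (Sum.map₂ ,-injectiveˡ)

otherRow : ∀ {P : Set} {z x y′ y : ℕ} → y′ ≢ y → P ⊎ (z , y′) ≡ (x , y) → P
otherRow y′≢y = [ (λ p → p) , (λ same → ⊥-elim (y′≢y (cong proj₂ same))) ]′

adds⇒growsRow : ∀ {l μ x y} → Adds l (x , y) μ → GrowsRow l (x , y) μ
adds⇒growsRow {l} {μ} {x} {y} (x∉l , memb) = proj₁ grown , proj₂ grown , unchanged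
  where
  grown : row l y ≡ x × row μ y ≡ suc x
  grown = <-extension x∉l (λ z → ⇔-sym sameRow⇔ ⇔-∘ memb (z , y))

  unchanged : ∀ y′ → y′ ≢ y → row μ y′ ≡ row l y′
  unchanged y′ y′≢y =
    <-ext (λ z → mk⇔ (otherRow y′≢y ∘ to (memb (z , y′))) (from (memb (z , y′)) ∘ inj₁))

growsRow⇒adds : ∀ {l μ x y} → GrowsRow l (x , y) μ → Adds l (x , y) μ
growsRow⇒adds {l} {μ} {x} {y} (old , new , unchanged) = x∉l , memb
  where
  x∉l : ¬ x < row l y
  x∉l x<l = <-irrefl refl (subst (x <_) old x<l)

  memb : ∀ b → (b ∈YD μ) ⇔ ((b ∈YD l) ⊎ b ≡ (x , y))
  memb (z , y′) with y′ ≟ y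
  ... | yes refl rewrite new | old = sameRow⇔ ⇔-∘ <-suc⇔
  ... | no y′≢y rewrite unchanged y′ y′≢y = mk⇔ inj₁ (otherRow y′≢y)

adds-⊆ : ∀ {l μ b} → Adds l b μ → ∀ z → row l z ≤ row μ z
adds-⊆ (_ , memb) z = <-⊆⇒≤ (λ w w<l → from (memb (w , z)) (inj₁ w<l))

added-unique : ∀ {l μ b c} → Adds l b μ → Adds l c μ → b ≡ c
added-unique {c = c} (_ , memb-b) (c∉l , memb-c) with to (memb-b c) (from (memb-c c) (inj₂ refl))
... | inj₁ c∈l = ⊥-elim (c∉l c∈l)
... | inj₂ c≡b = sym c≡b

adds? : ∀ {l μ} → l ↗ μ → (c : Box) → Dec (Adds l c μ)
adds? {l} {μ} (b , ad) c with ≡-dec _≟_ _≟_ b c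
... | yes refl = yes ad
... | no b≢c   = no (b≢c ∘ added-unique {l} {μ} ad)

outerCorner-row : ∀ {l x y} → OuterCorner l (x , y) → row l y ≡ x
outerCorner-row {l} (μ , ad) = proj₁ (adds⇒growsRow {l} {μ} ad)

outerCorner-supported : ∀ {l x y} → OuterCorner l (x , y) → Supported (rows l) y x
outerCorner-supported {y = zero}          _        = tt
outerCorner-supported {l} {x} {suc z} (μ , ad) = begin-strict
  x              <⟨ n<1+n x ⟩
  suc x          ≡⟨ sym new ⟩
  row μ (suc z)  ≤⟨ rowLen-antitone (rows μ) (valid μ) z ⟩
  row μ z        ≡⟨ unchanged z (<⇒≢ (n<1+n z)) ⟩
  row l z        ∎
  where
  new : row μ (suc z) ≡ suc x
  new = proj₁ (proj₂ (adds⇒growsRow {l} {μ} ad))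

  unchanged : ∀ y′ → y′ ≢ suc z → row μ y′ ≡ row l y′
  unchanged = proj₂ (proj₂ (adds⇒growsRow {l} {μ} ad))

outerCorner-intro : ∀ (l : YD) {x y} → row l y ≡ x → Supported (rows l) y x → OuterCorner l (x , y)
outerCorner-intro l {y = y} refl sup =
  grown , growsRow⇒adds {l} {grown} (refl , growRow-here (rows l) y , growRow-elsewhere (rows l))
  where
  grown : YD
  grown = yd (growRow (rows l) y) (growRow-valid (rows l) y (valid l) sup)

outerCorners-sameRow : ∀ {l c₁ c₂} → OuterCorner l c₁ → OuterCorner l c₂
  → proj₂ c₁ ≡ proj₂ c₂ → c₁ ≡ c₂
outerCorners-sameRow {l} {_ , y} {_ , .y} oc₁ oc₂ refl =
  cong (_, y) (trans (sym (outerCorner-row {l} oc₁)) (outerCorner-row {l} oc₂))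

outerCorner-above : ∀ {l μ x y} → Adds l (x , y) μ → OuterCorner μ (row μ (suc y) , suc y)
outerCorner-above {l} {μ} {x} {y} ad with adds⇒growsRow {l} {μ} ad
... | old , new , unchanged = outerCorner-intro μ refl (begin-strict
  row μ (suc y)  ≡⟨ unchanged (suc y) 1+n≢n ⟩
  row l (suc y)  ≤⟨ rowLen-antitone (rows l) (valid l) y ⟩
  row l y        ≡⟨ old ⟩
  x              <⟨ n<1+n x ⟩
  suc x          ≡⟨ sym new ⟩
  row μ y        ∎)

outerCorner-persists : ∀ {l μ b x y} → Adds l b μ → b ≢ (x , y)
  → OuterCorner l (x , y) → OuterCorner μ (x , y)
outerCorner-persists {l} {μ} {bx , by} {x} {y} ad b≢c oc =
  outerCorner-intro μ row-y (supported-mono y (adds-⊆ {l} {μ} ad) (outerCorner-supported {l} oc))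
  where
  row-y : row μ y ≡ x
  row-y with by ≟ y | adds⇒growsRow {l} {μ} ad
  ... | yes refl | old , _ , _ = ⊥-elim (b≢c (cong (_, y) (trans (sym old) (outerCorner-row {l} oc))))
  ... | no by≢y  | _ , _ , unchanged = trans (unchanged y (≢-sym by≢y)) (outerCorner-row {l} oc)

liftEdge : (Λ : AYD) {μ : YD} → diag Λ ↗ μ → Σ AYD λ Λ′ → diag Λ′ ≡ μ × Λ ↗* Λ′
liftEdge (ayd l (x , y) oc) {μ} (b , ad) with ≡-dec _≟_ _≟_ b (x , y)
... | yes refl =
  ayd μ (row μ (suc y) , suc y) (outerCorner-above {l} {μ} ad) ,
  refl , (b , ad) , (λ _ → refl) , (λ ¬ad → ⊥-elim (¬ad ad))
... | no b≢c =
  ayd μ (x , y) (outerCorner-persists {l} {μ} ad b≢c oc) ,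
  refl , (b , ad) , (λ adc → ⊥-elim (b≢c (added-unique {l} {μ} ad adc))) , (λ _ → refl)

liftEdge-unique : ∀ Λ₁ Λ₂ Λ₁′ Λ₂′ → Λ₁ ≈A Λ₂ → diag Λ₁′ ≡ diag Λ₂′
  → Λ₁ ↗* Λ₁′ → Λ₂ ↗* Λ₂′ → Λ₁′ ≈A Λ₂′
liftEdge-unique (ayd l c _) (ayd .l .c _) (ayd μ c₁ oc₁) (ayd .μ c₂ oc₂)
                (refl , refl) refl (edge , moved₁ , kept₁) (_ , moved₂ , kept₂) = refl , corners
  where
  corners : c₁ ≡ c₂
  corners with adds? {l} {μ} edge c
  ... | yes ad  = outerCorners-sameRow {μ} oc₁ oc₂ (trans (moved₁ ad) (sym (moved₂ ad)))
  ... | no ¬ad = trans (kept₁ ¬ad) (sym (kept₂ ¬ad))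

Over : YD → Set
Over μ = Σ AYD λ Λ → p Λ ≡ μ

liftOver : ∀ {μ ν} → Over μ → μ ↗ ν → Over ν
liftOver {ν = ν} (Λ , refl) e = proj₁ (liftEdge Λ {ν} e) , proj₁ (proj₂ (liftEdge Λ {ν} e))

liftOver-edge : ∀ {μ ν} (L : Over μ) (e : μ ↗ ν) → proj₁ L ↗* proj₁ (liftOver {ν = ν} L e)
liftOver-edge {ν = ν} (Λ , refl) e = proj₂ (proj₂ (liftEdge Λ {ν} e))

liftPath : (μs : ℕ → YD) → (∀ k → μs k ↗ μs (suc k)) → Over (μs 0) → (k : ℕ) → Over (μs k)
liftPath μs edges start zero    = start
liftPath μs edges start (suc k) = liftOver (liftPath μs edges start k) (edges k)

-- A lift exists: lift the shifted path k ↦ λs (k + m) and read it at k = t − m.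
lift-exists : ∀ m Λm λs → (∀ t → m ≤ t → λs t ↗ λs (suc t)) → λs m ≡ p Λm
  → Σ (ℕ → AYD) (IsLift m Λm λs)
lift-exists m Λm λs edge start = Λ , Λ-start , Λ-edge , Λ-over
  where
  path-edge : ∀ k → λs (k + m) ↗ λs (suc k + m)
  path-edge k = edge (k + m) (m≤n+m m k)

  lifted : (k : ℕ) → Over (λs (k + m))
  lifted = liftPath (λ k → λs (k + m)) path-edge (Λm , sym start)

  Λ : ℕ → AYD
  Λ t = proj₁ (lifted (t ∸ m))

  Λ-start : Λ m ≈A Λm
  Λ-start rewrite n∸n≡0 m = refl , refl

  lifted-edge : ∀ k → proj₁ (lifted k) ↗* proj₁ (lifted (suc k))
  lifted-edge k = liftOver-edge (lifted k) (path-edge k)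

  Λ-edge : ∀ t → m ≤ t → Λ t ↗* Λ (suc t)
  Λ-edge t m≤t rewrite +-∸-assoc 1 m≤t = lifted-edge (t ∸ m)

  Λ-over : ∀ t → m ≤ t → p (Λ t) ≡ λs t
  Λ-over t m≤t = trans (proj₂ (lifted (t ∸ m))) (cong λs (m∸n+n≡m m≤t))

lifts-agree : ∀ m Λm λs Λ₁ Λ₂ → IsLift m Λm λs Λ₁ → IsLift m Λm λs Λ₂
  → ∀ t → m ≤ t → Λ₁ t ≈A Λ₂ t
lifts-agree m _ _ Λ₁ Λ₂ (start₁ , edge₁ , over₁) (start₂ , edge₂ , over₂) t m≤t =
  subst (λ s → Λ₁ s ≈A Λ₂ s) (m∸n+n≡m m≤t) (agree (t ∸ m))
  where
  agree : ∀ k → Λ₁ (k + m) ≈A Λ₂ (k + m)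
  agree zero    = trans (proj₁ start₁) (sym (proj₁ start₂)) , trans (proj₂ start₁) (sym (proj₂ start₂))
  agree (suc k) = liftEdge-unique (Λ₁ (k + m)) (Λ₂ (k + m)) (Λ₁ (suc k + m)) (Λ₂ (suc k + m))
                                  (agree k) (trans (over₁ _ later) (sym (over₂ _ later)))
                                  (edge₁ (k + m) (m≤n+m m k)) (edge₂ (k + m) (m≤n+m m k))
    where
    later : m ≤ suc k + m
    later = m≤n+m m (suc k)

lemma3p4 : (m : ℕ) (Λm : AYD) (λs : ℕ → YD)
    → (∀ t → m ≤ t → λs t ↗ λs (suc t))
    → λs m ≡ p Λm
    → Σ (ℕ → AYD) λ Λ → IsLift m Λm λs Λ
        × (∀ Λ' → IsLift m Λm λs Λ' → ∀ t → m ≤ t → Λ' t ≈A Λ t)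
lemma3p4 m Λm λs edges start with lift-exists m Λm λs edges start
... | Λ , isLift = Λ , isLift , λ Λ′ isLift′ → lifts-agree m Λm λs Λ′ Λ isLift′ isLift
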